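{- Let $G$ be a finite vertex-transitive simple graph, let $v$ be any vertex of $G$, and let $P$ be a solvable pebble distribution on $G$. Then $$|P|\;\geq\;\frac{|V(G)|+\mathrm{TE}(P)}{\mathrm{ef}(v)}.$$
   Context: A pebble distribution $P$ on $G$ is a function $V(G)\to\mathbb{Z}_{\geq 0}$; $|P|=\sum_v P(v)$. A pebbling move from a vertex $u$ with at least two pebbles to a neighbor $w$ removes two pebbles from $u$ and adds one pebble to $w$. A vertex $w$ is $k$-reachable under $P$ if some sequence of pebbling moves (each keeping all pebble counts nonnegative) yields a distribution with at least $k$ pebbles on $w$; reachable means $1$-reachable. $P$ is solvable if every vertex is reachable. $\mathrm{reach}(P,w)$ is the largest $k$ such that $w$ is $k$-reachable; $\mathrm{exc}(P,w)=\mathrm{reach}(P,w)-1$ if $w$ is reachable and $0$ otherwise; $\mathrm{TE}(P)=\sum_{w\in V(G)}\mathrm{exc}(P,w)$. $N_i(v)$ is the set of vertices at distance exactly $i$ from $v$, and $\mathrm{ef}(v)=\sum_{i\geq 0}(1/2)^i|N_i(v)|$ (independent of $v$ by vertex-transitivity). -}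

module Defs where

open import Data.Nat as ℕ using (ℕ; zero; suc; _∸_)
open import Data.Bool using (Bool; true; false; _∨_; _∧_; not; if_then_else_)
open import Data.Fin using (Fin; zero; suc; _≟_)
open import Data.Fin.Permutation using (Permutation′; _⟨$⟩ʳ_)
open import Data.Integer using (+_)
open import Data.Rational as ℚ using (ℚ; ½; 1ℚ; 0ℚ)
open import Data.Product using (Σ; _×_; _,_)
open import Data.Sum using (_⊎_)
open import Relation.Nullary using (¬_; does)
open import Relation.Binary.PropositionalEquality using (_≡_)
open import Relation.Binary.Construct.Closure.ReflexiveTransitive using (Star)

record SimpleGraph (n : ℕ) : Set where
  field
    adj     : Fin n → Fin n → Bool
    adj-sym : ∀ u w → adj u w ≡ adj w u
    irrefl  : ∀ u → adj u u ≡ false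
open SimpleGraph public

IsAutomorphism : ∀ {n} → SimpleGraph n → Permutation′ n → Set
IsAutomorphism G σ = ∀ x y → adj G (σ ⟨$⟩ʳ x) (σ ⟨$⟩ʳ y) ≡ adj G x y

VertexTransitive : ∀ {n} → SimpleGraph n → Set
VertexTransitive {n} G =
  ∀ (u w : Fin n) → Σ (Permutation′ n) λ σ → IsAutomorphism G σ × (σ ⟨$⟩ʳ u ≡ w)

sumFin : ∀ {n} → (Fin n → ℕ) → ℕ
sumFin {zero}  f = 0
sumFin {suc n} f = f zero ℕ.+ sumFin (λ i → f (suc i))

anyFin : ∀ {n} → (Fin n → Bool) → Bool
anyFin {zero}  f = false
anyFin {suc n} f = f zero ∨ anyFin (λ i → f (suc i))

countFin : ∀ {n} → (Fin n → Bool) → ℕ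
countFin f = sumFin (λ i → if f i then 1 else 0)

-- Distances: ball k v w = true  iff  dist(v,w) ≤ k

ball : ∀ {n} → SimpleGraph n → ℕ → Fin n → Fin n → Bool
ball G zero    v w = does (v ≟ w)
ball G (suc k) v w = ball G k v w ∨ anyFin (λ u → ball G k v u ∧ adj G u w)

-- sphere k v w = true  iff  dist(v,w) = k, i.e. w ∈ N_k(v)
sphere : ∀ {n} → SimpleGraph n → ℕ → Fin n → Fin n → Bool
sphere G zero    v w = ball G zero v w
sphere G (suc k) v w = ball G (suc k) v w ∧ not (ball G k v w)

sphereSize : ∀ {n} → SimpleGraph n → ℕ → Fin n → ℕ
sphereSize G k v = countFin (sphere G k v)

-- ef(v) = Σ_{i ≥ 0} (1/2)^i |N_i(v)|.  In a graph on n vertices every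
-- distance is < n, so N_i(v) = ∅ for i ≥ n and the sum is over i < n.

halfPow : ℕ → ℚ
halfPow zero    = 1ℚ
halfPow (suc i) = ½ ℚ.* halfPow i

toℚ : ℕ → ℚ
toℚ m = + m ℚ./ 1

sumℚ : ℕ → (ℕ → ℚ) → ℚ
sumℚ zero    f = 0ℚ
sumℚ (suc k) f = sumℚ k f ℚ.+ f k

ef : ∀ {n} → SimpleGraph n → Fin n → ℚ
ef {n} G v = sumℚ n (λ i → halfPow i ℚ.* toℚ (sphereSize G i v))

Distribution : ℕ → Set
Distribution n = Fin n → ℕ

size : ∀ {n} → Distribution n → ℕ
size P = sumFin P

-- A pebbling move from u to a neighbour w: Q = P - 2·e_u + e_w
-- (written additively: Q x + 2[x = u] = P x + [x = w]).
record Move {n} (G : SimpleGraph n) (P Q : Distribution n) : Set where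
  field
    from     : Fin n
    to       : Fin n
    isEdge   : adj G from to ≡ true
    enough   : 2 ℕ.≤ P from
    result   : ∀ x → Q x ℕ.+ (if does (x ≟ from) then 2 else 0)
                     ≡ P x ℕ.+ (if does (x ≟ to) then 1 else 0)

Moves : ∀ {n} → SimpleGraph n → Distribution n → Distribution n → Set
Moves G = Star (Move G)

KReachable : ∀ {n} → SimpleGraph n → Distribution n → ℕ → Fin n → Set
KReachable G P k w = Σ _ λ Q → Moves G P Q × (k ℕ.≤ Q w)

Reachable : ∀ {n} → SimpleGraph n → Distribution n → Fin n → Set
Reachable G P w = KReachable G P 1 w

Solvable : ∀ {n} → SimpleGraph n → Distribution n → Set
Solvable G P = ∀ w → Reachable G P w

IsReach : ∀ {n} → SimpleGraph n → Distribution n → Fin n → ℕ → Set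
IsReach G P w k = KReachable G P k w × (∀ m → KReachable G P m w → m ℕ.≤ k)

IsExc : ∀ {n} → SimpleGraph n → Distribution n → Fin n → ℕ → Set
IsExc G P w e =
  (Reachable G P w × IsReach G P w (suc e)) ⊎ (¬ Reachable G P w × e ≡ 0)

-- TE(P) = Σ_w exc(P,w), given the function of excesses
TE : ∀ {n} → (Fin n → ℕ) → ℕ
TE exc = sumFin exc

module Submission where

-- For a distribution P and a target w consider the potential Σ_u P(u) · 2^(n ∸ d(u,w)).
-- A pebbling move from a to a neighbour b removes two pebbles weighing 2^(n ∸ d(a,w)) each
-- and adds one weighing 2^(n ∸ d(b,w)) ≤ 2 · 2^(n ∸ d(a,w)), so the potential never
-- increases; and once k pebbles sit on w it is at least k · 2ⁿ. Hence
-- 2ⁿ · reach(P,w) ≤ potential(P,w), and summing over w gives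
-- 2ⁿ (n + TE(P)) ≤ Σ_u P(u) · 2ⁿ ef(u), where ef(u) = ef(v) by vertex-transitivity.

open import Defs

import Algebra.Properties.CommutativeMonoid.Sum as CommutativeMonoidSum
import Algebra.Properties.Semiring.Sum as SemiringSum
open import Data.Bool using (Bool; true; false; T; _∨_; _∧_; not; if_then_else_)
open import Data.Bool.Properties using (∨-commutativeMonoid; T-∨; T-∧; T-≡; T?)
open import Data.Empty using (⊥-elim)
open import Data.Fin using (Fin; zero; suc; _≟_)
open import Data.Fin.Permutation using (Permutation′; _⟨$⟩ʳ_; _⟨$⟩ˡ_; inverseˡ)
open import Data.Fin.Properties using (any?; toℕ<n)
import Data.Integer as ℤ
import Data.Integer.Properties as ℤ
open import Data.Nat as ℕ using (ℕ; zero; suc; _+_; _*_; _≤_; _<_; _∸_; _^_; z≤n; s≤s)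
import Data.Nat.Properties as ℕ
open import Data.Nat.Coprimality as Coprimality using (1-coprimeTo)
open import Data.Product using (∃; _×_; _,_; proj₁; proj₂)
import Data.Rational as ℚ
import Data.Rational.Properties as ℚ
open import Data.Rational.Solver using (module +-*-Solver)
import Data.Rational.Unnormalised as ℚᵘ
import Data.Rational.Unnormalised.Properties as ℚᵘ
open import Data.Sum using (_⊎_; inj₁; inj₂)
open import Function using (_∘_; case_of_; Equivalence)
open import Relation.Binary using (tri<; tri≈; tri>)
open import Relation.Binary.Construct.Closure.ReflexiveTransitive using (ε; _◅_)
open import Relation.Binary.PropositionalEquality
open import Relation.Nullary using (¬_; does; yes; no)

open import Algebra.Properties.CommutativeSemigroup ℕ.+-commutativeSemigroup using (x∙yz≈y∙xz)
open SemiringSum ℕ.+-*-semiring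
  using (sum; sum-cong-≗; sum-replicate-zero; ∑-distrib-+; ∑-comm; sum-permute; *-distribˡ-sum; *-distribʳ-sum)
open CommutativeMonoidSum ∨-commutativeMonoid using () renaming (sum to ⋁; sum-permute to ⋁-permute)
open Equivalence using (to; from)
open +-*-Solver using (solve; _:*_; _:=_)

sumFin≡sum : ∀ {n} (f : Fin n → ℕ) → sumFin f ≡ sum f
sumFin≡sum {zero}  f = refl
sumFin≡sum {suc n} f = cong (f zero +_) (sumFin≡sum (f ∘ suc))

anyFin≡⋁ : ∀ {n} (f : Fin n → Bool) → anyFin f ≡ ⋁ f
anyFin≡⋁ {zero}  f = refl
anyFin≡⋁ {suc n} f = cong (f zero ∨_) (anyFin≡⋁ (f ∘ suc))

sum-mono-≤ : ∀ {n} {f g : Fin n → ℕ} → (∀ i → f i ≤ g i) → sum f ≤ sum g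
sum-mono-≤ {zero}  f≤g = z≤n
sum-mono-≤ {suc n} f≤g = ℕ.+-mono-≤ (f≤g zero) (sum-mono-≤ (f≤g ∘ suc))

sum-mono-< : ∀ {n} {f g : Fin n → ℕ} → (∀ i → f i ≤ g i) → ∀ a → f a < g a → sum f < sum g
sum-mono-< f≤g zero    𝟙-< = ℕ.+-mono-<-≤ 𝟙-< (sum-mono-≤ (f≤g ∘ suc))
sum-mono-< f≤g (suc a) 𝟙-< = ℕ.+-mono-≤-< (f≤g zero) (sum-mono-< (f≤g ∘ suc) a 𝟙-<)

term≤sum : ∀ {n} (f : Fin n → ℕ) a → f a ≤ sum f
term≤sum f zero    = ℕ.m≤m+n (f zero) _
term≤sum f (suc a) = ℕ.≤-trans (term≤sum (f ∘ suc) a) (ℕ.m≤n+m _ (f zero))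

sum-suc : ∀ {n} (f : Fin n → ℕ) → sum (λ i → suc (f i)) ≡ n + sum f
sum-suc {zero}  f = refl
sum-suc {suc n} f = cong suc (trans (cong (f zero +_) (sum-suc (f ∘ suc))) (x∙yz≈y∙xz (f zero) n (sum (f ∘ suc))))

weighted-sum-+ : ∀ {n} (f g c : Fin n → ℕ) →
                 sum (λ x → (f x + g x) * c x) ≡ sum (λ x → f x * c x) + sum (λ x → g x * c x)
weighted-sum-+ f g c = trans (sum-cong-≗ (λ x → ℕ.*-distribʳ-+ (c x) (f x) (g x))) (∑-distrib-+ (λ x → f x * c x) (λ x → g x * c x))

pointMass : ∀ {n} → Fin n → ℕ → Fin n → ℕ
pointMass a k x = if does (x ≟ a) then k else 0

sum-pointMass : ∀ {n} a k (c : Fin n → ℕ) → sum (λ x → pointMass a k x * c x) ≡ k * c a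
sum-pointMass {suc n} zero    k c = begin
  k * c zero + sum {n} (λ _ → 0)  ≡⟨ cong (k * c zero +_) (sum-replicate-zero n) ⟩
  k * c zero + 0                  ≡⟨ ℕ.+-identityʳ _ ⟩
  k * c zero                      ∎
  where open ≡-Reasoning
sum-pointMass {suc n} (suc a) k c = sum-pointMass a k (c ∘ suc)

𝟙 : Bool → ℕ
𝟙 b = if b then 1 else 0

𝟙≤1 : ∀ b → 𝟙 b ≤ 1
𝟙≤1 true  = ℕ.≤-refl
𝟙≤1 false = z≤n

𝟙-mono : ∀ {a b} → (T a → T b) → 𝟙 a ≤ 𝟙 b
𝟙-mono {false}         a⇒b = z≤n
𝟙-mono {true}  {true}  a⇒b = ℕ.≤-refl
𝟙-mono {true}  {false} a⇒b = ⊥-elim (a⇒b _)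

𝟙-true : ∀ {b} → T b → 𝟙 b ≡ 1
𝟙-true {true} _ = refl

𝟙-false : ∀ {b} → ¬ T b → 𝟙 b ≡ 0
𝟙-false {false} _  = refl
𝟙-false {true}  ¬b = ⊥-elim (¬b _)

T-not⇒¬T : ∀ {b} → T (not b) → ¬ T b
T-not⇒¬T {false} _ ()

¬T⇒T-not : ∀ {b} → ¬ T b → T (not b)
¬T⇒T-not {false} _  = _
¬T⇒T-not {true}  ¬b = ¬b _

countFin≤ : ∀ {n} (f : Fin n → Bool) → countFin f ≤ n
countFin≤ {zero}  f = z≤n
countFin≤ {suc n} f = ℕ.+-mono-≤ (𝟙≤1 (f zero)) (countFin≤ (f ∘ suc))

countFin-< : ∀ {n} {f g : Fin n → Bool} → (∀ i → T (f i) → T (g i)) →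
             ∀ a → T (g a) → ¬ T (f a) → countFin f < countFin g
countFin-< {f = f} {g} f⇒g a ga ¬fa = subst₂ _<_ (sym (sumFin≡sum (𝟙 ∘ f))) (sym (sumFin≡sum (𝟙 ∘ g)))
  (sum-mono-< (λ i → 𝟙-mono (f⇒g i)) a (𝟙-< (f a) (g a) ga ¬fa))
  where
  𝟙-< : ∀ x y → T y → ¬ T x → 𝟙 x < 𝟙 y
  𝟙-< false true _ _ = ℕ.≤-refl
  𝟙-< true  _    _ ¬x = ⊥-elim (¬x _)

anyFin⁺ : ∀ {n} (f : Fin n → Bool) i → T (f i) → T (anyFin f)
anyFin⁺ f zero    fi = from T-∨ (inj₁ fi)
anyFin⁺ f (suc i) fi = from T-∨ (inj₂ (anyFin⁺ (f ∘ suc) i fi))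

anyFin⁻ : ∀ {n} (f : Fin n → Bool) → T (anyFin f) → ∃ λ i → T (f i)
anyFin⁻ {suc n} f any with to T-∨ any
... | inj₁ f0   = zero , f0
... | inj₂ any′ with i , fi ← anyFin⁻ (f ∘ suc) any′ = suc i , fi

anyFin-cong : ∀ {n} {f g : Fin n → Bool} → (∀ i → f i ≡ g i) → anyFin f ≡ anyFin g
anyFin-cong {zero}  f≗g = refl
anyFin-cong {suc n} f≗g = cong₂ _∨_ (f≗g zero) (anyFin-cong (f≗g ∘ suc))

anyFin-permute : ∀ {n} (σ : Permutation′ n) (f : Fin n → Bool) → anyFin (f ∘ (σ ⟨$⟩ʳ_)) ≡ anyFin f
anyFin-permute {n} σ f = begin
  anyFin (f ∘ (σ ⟨$⟩ʳ_))  ≡⟨ anyFin≡⋁ (f ∘ (σ ⟨$⟩ʳ_)) ⟩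
  ⋁ (f ∘ (σ ⟨$⟩ʳ_))       ≡⟨ ⋁-permute f σ ⟨
  ⋁ {n} f                 ≡⟨ anyFin≡⋁ f ⟨
  anyFin f                ∎
  where open ≡-Reasoning

module Balls {n} (G : SimpleGraph n) where

  ball-suc⁺ : ∀ k v w → T (ball G k v w) → T (ball G (suc k) v w)
  ball-suc⁺ k v w b = from T-∨ (inj₁ b)

  ball-extend : ∀ k v u w → T (ball G k v u) → T (adj G u w) → T (ball G (suc k) v w)
  ball-extend k v u w b e = from T-∨ (inj₂ (anyFin⁺ _ u (from T-∧ (b , e))))

  ball-suc⁻ : ∀ k v w → T (ball G (suc k) v w) →
              T (ball G k v w) ⊎ ∃ λ u → T (ball G k v u) × T (adj G u w)
  ball-suc⁻ k v w b with to T-∨ b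
  ... | inj₁ b′  = inj₁ b′
  ... | inj₂ any with u , bu ← anyFin⁻ _ any = inj₂ (u , to T-∧ bu)

  ball-center : ∀ k v → T (ball G k v v)
  ball-center zero    v with v ≟ v
  ... | yes _  = _
  ... | no v≢v = v≢v refl
  ball-center (suc k) v = ball-suc⁺ k v v (ball-center k v)

  ball-zero⁻ : ∀ v w → T (ball G 0 v w) → v ≡ w
  ball-zero⁻ v w b with v ≟ w
  ... | yes v≡w = v≡w
  ... | no _    = ⊥-elim b

  ball-cons : ∀ k a b w → T (adj G a b) → T (ball G k b w) → T (ball G (suc k) a w)
  ball-cons zero    a b w e bw with refl ← ball-zero⁻ b w bw = ball-extend 0 a a b (ball-center 0 a) e
  ball-cons (suc k) a b w e bw with ball-suc⁻ k b w bw
  ... | inj₁ bw′           = ball-suc⁺ (suc k) a w (ball-cons k a b w e bw′)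
  ... | inj₂ (u , bu , eu) = ball-extend (suc k) a u w (ball-cons k a b u e bu) eu

  Stable : Fin n → ℕ → Set
  Stable a k = ∀ w → T (ball G (suc k) a w) → T (ball G k a w)

  stable-ball : ∀ a k → Stable a k → ∀ m w → T (ball G (m + k) a w) → T (ball G k a w)
  stable-ball a k st zero    w b = b
  stable-ball a k st (suc m) w b with ball-suc⁻ (m + k) a w b
  ... | inj₁ b′            = stable-ball a k st m w b′
  ... | inj₂ (u , bu , eu) = st w (ball-extend k a u w (stable-ball a k st m u bu) eu)

  stable-or-growing : ∀ a m → (∃ λ k → k < m × Stable a k) ⊎ m < countFin (ball G m a)
  stable-or-growing a zero = inj₂ (ℕ.≤-trans (s≤s z≤n)
    (countFin-< {f = λ _ → false} (λ _ ()) a (ball-center 0 a) (λ ())))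
  stable-or-growing a (suc m) with stable-or-growing a m
  ... | inj₁ (k , k<m , st) = inj₁ (k , ℕ.m<n⇒m<1+n k<m , st)
  ... | inj₂ grows with any? (λ w → T? (sphere G (suc m) a w))
  ...   | yes (w , new) = inj₂ (ℕ.≤-trans (s≤s grows)
          (countFin-< (ball-suc⁺ m a) w (proj₁ (to T-∧ new)) (T-not⇒¬T (proj₂ (to T-∧ new)))))
  ...   | no ¬new = inj₁ (m , ℕ.n<1+n m , λ w b → old w b (¬new ∘ (w ,_)))
    where
    old : ∀ w → T (ball G (suc m) a w) → ¬ T (sphere G (suc m) a w) → T (ball G m a w)
    old w b ¬s with ball G m a w
    ... | true  = _
    ... | false = ¬s (from T-∧ (b , _))

  -- Pigeonhole: balls that grew at every radius up to n would hold more than n vertices.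
  ball-radius<n : ∀ j a w → T (ball G j a w) → ∃ λ e → e < n × e ≤ j × T (ball G e a w)
  ball-radius<n j a w b with j ℕ.<? n
  ... | yes j<n = j , j<n , ℕ.≤-refl , b
  ... | no j≮n with stable-or-growing a n
  ...   | inj₂ grows = ⊥-elim (ℕ.<⇒≱ grows (countFin≤ (ball G n a)))
  ...   | inj₁ (k , k<n , st) = k , k<n , k≤j ,
          stable-ball a k st (j ∸ k) w (subst (λ r → T (ball G r a w)) (sym (ℕ.m∸n+n≡m k≤j)) b)
    where
    k≤j : k ≤ j
    k≤j = ℕ.≤-trans (ℕ.<⇒≤ k<n) (ℕ.≮⇒≥ j≮n)

module Automorphism {n} (G : SimpleGraph n) (σ : Permutation′ n) (aut : IsAutomorphism G σ) where

  σ-injective : ∀ {x y} → σ ⟨$⟩ʳ x ≡ σ ⟨$⟩ʳ y → x ≡ y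
  σ-injective {x} {y} σx≡σy = begin
    x                      ≡⟨ inverseˡ σ ⟨
    σ ⟨$⟩ˡ (σ ⟨$⟩ʳ x)      ≡⟨ cong (σ ⟨$⟩ˡ_) σx≡σy ⟩
    σ ⟨$⟩ˡ (σ ⟨$⟩ʳ y)      ≡⟨ inverseˡ σ ⟩
    y                      ∎
    where open ≡-Reasoning

  ball-aut : ∀ k x y → ball G k (σ ⟨$⟩ʳ x) (σ ⟨$⟩ʳ y) ≡ ball G k x y
  ball-aut zero x y with σ ⟨$⟩ʳ x ≟ σ ⟨$⟩ʳ y | x ≟ y
  ... | yes _     | yes _    = refl
  ... | no _      | no _     = refl
  ... | yes σx≡σy | no x≢y   = ⊥-elim (x≢y (σ-injective σx≡σy))
  ... | no σx≢σy  | yes refl = ⊥-elim (σx≢σy refl)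
  ball-aut (suc k) x y = cong₂ _∨_ (ball-aut k x y) (begin
    anyFin (λ u → ball G k (σ ⟨$⟩ʳ x) u ∧ adj G u (σ ⟨$⟩ʳ y))
      ≡⟨ anyFin-permute σ _ ⟨
    anyFin (λ u → ball G k (σ ⟨$⟩ʳ x) (σ ⟨$⟩ʳ u) ∧ adj G (σ ⟨$⟩ʳ u) (σ ⟨$⟩ʳ y))
      ≡⟨ anyFin-cong (λ u → cong₂ _∧_ (ball-aut k x u) (aut u y)) ⟩
    anyFin (λ u → ball G k x u ∧ adj G u y)
      ∎)
    where open ≡-Reasoning

  sphere-aut : ∀ k x y → sphere G k (σ ⟨$⟩ʳ x) (σ ⟨$⟩ʳ y) ≡ sphere G k x y
  sphere-aut zero    x y = ball-aut zero x y
  sphere-aut (suc k) x y = cong₂ (λ b b′ → b ∧ not b′) (ball-aut (suc k) x y) (ball-aut k x y)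

  sphereSize-aut : ∀ k x → sphereSize G k (σ ⟨$⟩ʳ x) ≡ sphereSize G k x
  sphereSize-aut k x = begin
    countFin (sphere G k (σ ⟨$⟩ʳ x))                  ≡⟨ sumFin≡sum (𝟙 ∘ sphere G k (σ ⟨$⟩ʳ x)) ⟩
    sum (𝟙 ∘ sphere G k (σ ⟨$⟩ʳ x))                   ≡⟨ sum-permute _ σ ⟩
    sum (λ y → 𝟙 (sphere G k (σ ⟨$⟩ʳ x) (σ ⟨$⟩ʳ y)))  ≡⟨ sum-cong-≗ (cong 𝟙 ∘ sphere-aut k x) ⟩
    sum (𝟙 ∘ sphere G k x)                            ≡⟨ sumFin≡sum (𝟙 ∘ sphere G k x) ⟨
    countFin (sphere G k x)                           ∎
    where open ≡-Reasoning

sumN : ℕ → (ℕ → ℕ) → ℕ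
sumN zero    f = 0
sumN (suc k) f = sumN k f + f k

sumN-cong : ∀ k {f g : ℕ → ℕ} → (∀ i → f i ≡ g i) → sumN k f ≡ sumN k g
sumN-cong zero    f≗g = refl
sumN-cong (suc k) f≗g = cong₂ _+_ (sumN-cong k f≗g) (f≗g k)

sumN-zero : ∀ k (f : ℕ → ℕ) → (∀ i → i < k → f i ≡ 0) → sumN k f ≡ 0
sumN-zero zero    f f≡0 = refl
sumN-zero (suc k) f f≡0 = cong₂ _+_ (sumN-zero k f (λ i → f≡0 i ∘ ℕ.m<n⇒m<1+n)) (f≡0 k ℕ.≤-refl)

sumN-single : ∀ k (f : ℕ → ℕ) d → d < k → (∀ i → i < k → i ≢ d → f i ≡ 0) → sumN k f ≡ f d
sumN-single (suc k) f d d<1+k f≡0 with d ℕ.≟ k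
... | yes refl = cong (_+ f d) (sumN-zero k f (λ i i<k → f≡0 i (ℕ.m<n⇒m<1+n i<k) (ℕ.<⇒≢ i<k)))
... | no d≢k   = begin
  sumN k f + f k  ≡⟨ cong₂ _+_ (sumN-single k f d d<k (λ i → f≡0 i ∘ ℕ.m<n⇒m<1+n)) (f≡0 k ℕ.≤-refl (d≢k ∘ sym)) ⟩
  f d + 0         ≡⟨ ℕ.+-identityʳ (f d) ⟩
  f d             ∎
  where
  open ≡-Reasoning
  d<k : d < k
  d<k = ℕ.≤∧≢⇒< (ℕ.≤-pred d<1+k) d≢k

sum-sumN : ∀ {n} k (h : ℕ → Fin n → ℕ) → sum (λ w → sumN k (λ i → h i w)) ≡ sumN k (λ i → sum (h i))
sum-sumN {n} zero    h = sum-replicate-zero n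
sum-sumN     (suc k) h = trans (∑-distrib-+ (λ w → sumN k (λ i → h i w)) (h k)) (cong (_+ sum (h k)) (sum-sumN k h))

m∸n≤1+m∸[1+n] : ∀ m n → m ∸ n ≤ suc (m ∸ suc n)
m∸n≤1+m∸[1+n] zero    zero    = z≤n
m∸n≤1+m∸[1+n] (suc m) zero    = ℕ.≤-refl
m∸n≤1+m∸[1+n] zero    (suc n) = z≤n
m∸n≤1+m∸[1+n] (suc m) (suc n) = m∸n≤1+m∸[1+n] m n

Monotone : (ℕ → Bool) → Set
Monotone f = ∀ i → T (f i) → T (f (suc i))

monotone-≤ : ∀ {f : ℕ → Bool} → Monotone f → ∀ {d j} → d ≤ j → T (f d) → T (f j)
monotone-≤ {f} mono {d} d≤j fd with o , refl ← ℕ.m≤n⇒∃[o]m+o≡n d≤j = go o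
  where
  go : ∀ o → T (f (d + o))
  go zero    = subst (T ∘ f) (sym (ℕ.+-identityʳ d)) fd
  go (suc o) = subst (T ∘ f) (sym (ℕ.+-suc d o)) (mono (d + o) (go o))

jump : (ℕ → Bool) → ℕ → Bool
jump f zero    = f zero
jump f (suc i) = f (suc i) ∧ not (f i)

-- For monotone f only the first index where f turns true contributes (weight-at).
weight : ℕ → (ℕ → Bool) → ℕ
weight N f = sumN N (λ i → 2 ^ (N ∸ i) * 𝟙 (jump f i))

data FirstTrue (f : ℕ → Bool) (N : ℕ) : Set where
  never : (∀ i → i < N → ¬ T (f i)) → FirstTrue f N
  at    : ∀ d → d < N → T (f d) → (∀ i → i < d → ¬ T (f i)) → FirstTrue f N

firstTrue : ∀ f N → FirstTrue f N
firstTrue f zero = never (λ _ ())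
firstTrue f (suc N) with firstTrue f N
... | at d d<N fd before = at d (ℕ.m<n⇒m<1+n d<N) fd before
... | never none with T? (f N)
...   | yes fN = at N ℕ.≤-refl fN none
...   | no ¬fN = never λ i i<1+N → case i ℕ.≟ N of λ where
  (yes refl) → ¬fN
  (no i≢N)   → none i (ℕ.≤∧≢⇒< (ℕ.≤-pred i<1+N) i≢N)

jump⇒true : ∀ f i → T (jump f i) → T (f i)
jump⇒true f zero    j = j
jump⇒true f (suc i) j = proj₁ (to T-∧ j)

jump-first : ∀ f d → T (f d) → (∀ i → i < d → ¬ T (f i)) → T (jump f d)
jump-first f zero    fd before = fd
jump-first f (suc d) fd before = from T-∧ (fd , ¬T⇒T-not (before d ℕ.≤-refl))

jump-after : ∀ f i → T (f i) → ¬ T (jump f (suc i))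
jump-after f i fi j = T-not⇒¬T (proj₂ (to T-∧ j)) fi

weight-never : ∀ N f → (∀ i → i < N → ¬ T (f i)) → weight N f ≡ 0
weight-never N f none = sumN-zero N _ λ i i<N →
  trans (cong (2 ^ (N ∸ i) *_) (𝟙-false (none i i<N ∘ jump⇒true f i))) (ℕ.*-zeroʳ (2 ^ (N ∸ i)))

weight-at : ∀ N f → Monotone f → ∀ d → d < N → T (f d) → (∀ i → i < d → ¬ T (f i)) →
            weight N f ≡ 2 ^ (N ∸ d)
weight-at N f mono d d<N fd before = begin
  weight N f                       ≡⟨ sumN-single N _ d d<N off-d ⟩
  2 ^ (N ∸ d) * 𝟙 (jump f d)       ≡⟨ cong (2 ^ (N ∸ d) *_) (𝟙-true (jump-first f d fd before)) ⟩
  2 ^ (N ∸ d) * 1                  ≡⟨ ℕ.*-identityʳ _ ⟩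
  2 ^ (N ∸ d)                      ∎
  where
  open ≡-Reasoning
  no-jump : ∀ i → i ≢ d → ¬ T (jump f i)
  no-jump i i≢d with ℕ.<-cmp i d
  ... | tri< i<d _ _ = before i i<d ∘ jump⇒true f i
  ... | tri≈ _ i≡d _ = ⊥-elim (i≢d i≡d)
  no-jump (suc i) _ | tri> _ _ (s≤s d≤i) = jump-after f i (monotone-≤ mono d≤i fd)
  off-d : ∀ i → i < N → i ≢ d → 2 ^ (N ∸ i) * 𝟙 (jump f i) ≡ 0
  off-d i _ i≢d = trans (cong (2 ^ (N ∸ i) *_) (𝟙-false (no-jump i i≢d))) (ℕ.*-zeroʳ (2 ^ (N ∸ i)))

weight-≥ : ∀ N f → Monotone f → ∀ d → d < N → T (f d) → 2 ^ (N ∸ d) ≤ weight N f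
weight-≥ N f mono d d<N fd with firstTrue f N
... | never none = ⊥-elim (none d d<N fd)
... | at d′ d′<N fd′ before = begin
  2 ^ (N ∸ d)    ≤⟨ ℕ.^-monoʳ-≤ 2 (ℕ.∸-monoʳ-≤ N d′≤d) ⟩
  2 ^ (N ∸ d′)   ≡⟨ weight-at N f mono d′ d′<N fd′ before ⟨
  weight N f     ∎
  where
  open ℕ.≤-Reasoning
  d′≤d : d′ ≤ d
  d′≤d = ℕ.≮⇒≥ (λ d<d′ → before d d<d′ fd)

toℚᵘ-toℚ : ∀ m → ℚ.toℚᵘ (toℚ m) ≡ ℚᵘ.mkℚᵘ (ℤ.+ m) 0
toℚᵘ-toℚ m rewrite ℚ.normalize-coprime {m} {0} (Coprimality.sym (1-coprimeTo m)) = refl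

toℚ-+ : ∀ a b → toℚ (a + b) ≡ toℚ a ℚ.+ toℚ b
toℚ-+ a b = ℚ.toℚᵘ-injective (begin
  ℚ.toℚᵘ (toℚ (a + b))                         ≡⟨ toℚᵘ-toℚ (a + b) ⟩
  ℚᵘ.mkℚᵘ (ℤ.+ (a + b)) 0                      ≈⟨ ℚᵘ.*≡* (cong (ℤ._* ℤ.1ℤ) numerator) ⟩
  ℚᵘ.mkℚᵘ (ℤ.+ a) 0 ℚᵘ.+ ℚᵘ.mkℚᵘ (ℤ.+ b) 0    ≡⟨ cong₂ ℚᵘ._+_ (toℚᵘ-toℚ a) (toℚᵘ-toℚ b) ⟨
  ℚ.toℚᵘ (toℚ a) ℚᵘ.+ ℚ.toℚᵘ (toℚ b)          ≈⟨ ℚ.toℚᵘ-homo-+ (toℚ a) (toℚ b) ⟨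
  ℚ.toℚᵘ (toℚ a ℚ.+ toℚ b)                     ∎)
  where
  open ℚᵘ.≃-Reasoning
  numerator : ℤ.+ (a + b) ≡ ℤ.+ a ℤ.* ℤ.1ℤ ℤ.+ ℤ.+ b ℤ.* ℤ.1ℤ
  numerator = trans (ℤ.pos-+ a b) (sym (cong₂ ℤ._+_ (ℤ.*-identityʳ (ℤ.+ a)) (ℤ.*-identityʳ (ℤ.+ b))))

toℚ-* : ∀ a b → toℚ (a * b) ≡ toℚ a ℚ.* toℚ b
toℚ-* a b = ℚ.toℚᵘ-injective (begin
  ℚ.toℚᵘ (toℚ (a * b))                         ≡⟨ toℚᵘ-toℚ (a * b) ⟩
  ℚᵘ.mkℚᵘ (ℤ.+ (a * b)) 0                      ≈⟨ ℚᵘ.*≡* (cong (ℤ._* ℤ.1ℤ) (ℤ.pos-* a b)) ⟩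
  ℚᵘ.mkℚᵘ (ℤ.+ a) 0 ℚᵘ.* ℚᵘ.mkℚᵘ (ℤ.+ b) 0    ≡⟨ cong₂ ℚᵘ._*_ (toℚᵘ-toℚ a) (toℚᵘ-toℚ b) ⟨
  ℚ.toℚᵘ (toℚ a) ℚᵘ.* ℚ.toℚᵘ (toℚ b)          ≈⟨ ℚ.toℚᵘ-homo-* (toℚ a) (toℚ b) ⟨
  ℚ.toℚᵘ (toℚ a ℚ.* toℚ b)                     ∎)
  where open ℚᵘ.≃-Reasoning

toℚ-mono-≤ : ∀ {a b} → a ≤ b → toℚ a ℚ.≤ toℚ b
toℚ-mono-≤ {a} {b} a≤b = ℚ.toℚᵘ-cancel-≤ (subst₂ ℚᵘ._≤_ (sym (toℚᵘ-toℚ a)) (sym (toℚᵘ-toℚ b))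
  (ℚᵘ.*≤* (ℤ.*-monoʳ-≤-nonNeg ℤ.1ℤ (ℤ.+≤+ a≤b))))

toℚ-positive : ∀ m .{{_ : ℕ.NonZero m}} → ℚ.Positive (toℚ m)
toℚ-positive (suc m) = subst ℚᵘ.Positive (sym (toℚᵘ-toℚ (suc m))) _

halfPow-*-2^ : ∀ i → halfPow i ℚ.* toℚ (2 ^ i) ≡ ℚ.1ℚ
halfPow-*-2^ zero    = refl
halfPow-*-2^ (suc i) = begin
  ℚ.½ ℚ.* halfPow i ℚ.* toℚ (2 * 2 ^ i)          ≡⟨ cong (ℚ.½ ℚ.* halfPow i ℚ.*_) (toℚ-* 2 (2 ^ i)) ⟩
  ℚ.½ ℚ.* halfPow i ℚ.* (toℚ 2 ℚ.* toℚ (2 ^ i))  ≡⟨ solve 4 (λ a h b t → (a :* h) :* (b :* t) := (a :* b) :* (h :* t))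
                                                      refl ℚ.½ (halfPow i) (toℚ 2) (toℚ (2 ^ i)) ⟩
  ℚ.½ ℚ.* toℚ 2 ℚ.* (halfPow i ℚ.* toℚ (2 ^ i))  ≡⟨ cong (ℚ.½ ℚ.* toℚ 2 ℚ.*_) (halfPow-*-2^ i) ⟩
  ℚ.1ℚ                                            ∎
  where open ≡-Reasoning

halfPow-scale : ∀ {i N} → i ≤ N → ∀ s → halfPow i ℚ.* toℚ s ℚ.* toℚ (2 ^ N) ≡ toℚ (2 ^ (N ∸ i) * s)
halfPow-scale {i} {N} i≤N s = begin
  h ℚ.* toℚ s ℚ.* toℚ (2 ^ N)                          ≡⟨ cong (λ e → h ℚ.* toℚ s ℚ.* toℚ (2 ^ e)) (ℕ.m+[n∸m]≡n i≤N) ⟨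
  h ℚ.* toℚ s ℚ.* toℚ (2 ^ (i + (N ∸ i)))              ≡⟨ cong (λ p → h ℚ.* toℚ s ℚ.* toℚ p) (ℕ.^-distribˡ-+-* 2 i (N ∸ i)) ⟩
  h ℚ.* toℚ s ℚ.* toℚ (2 ^ i * 2 ^ (N ∸ i))            ≡⟨ cong (h ℚ.* toℚ s ℚ.*_) (toℚ-* (2 ^ i) (2 ^ (N ∸ i))) ⟩
  h ℚ.* toℚ s ℚ.* (toℚ (2 ^ i) ℚ.* toℚ (2 ^ (N ∸ i)))
    ≡⟨ solve 4 (λ h s p q → (h :* s) :* (p :* q) := (h :* p) :* (q :* s)) refl h (toℚ s) (toℚ (2 ^ i)) (toℚ (2 ^ (N ∸ i))) ⟩
  h ℚ.* toℚ (2 ^ i) ℚ.* (toℚ (2 ^ (N ∸ i)) ℚ.* toℚ s)  ≡⟨ cong (ℚ._* (toℚ (2 ^ (N ∸ i)) ℚ.* toℚ s)) (halfPow-*-2^ i) ⟩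
  ℚ.1ℚ ℚ.* (toℚ (2 ^ (N ∸ i)) ℚ.* toℚ s)               ≡⟨ ℚ.*-identityˡ _ ⟩
  toℚ (2 ^ (N ∸ i)) ℚ.* toℚ s                          ≡⟨ toℚ-* (2 ^ (N ∸ i)) s ⟨
  toℚ (2 ^ (N ∸ i) * s)                                ∎
  where
  open ≡-Reasoning
  h : ℚ.ℚ
  h = halfPow i

sumℚ-scale : ∀ N (s : ℕ → ℕ) k → k ≤ N →
             sumℚ k (λ i → halfPow i ℚ.* toℚ (s i)) ℚ.* toℚ (2 ^ N) ≡ toℚ (sumN k (λ i → 2 ^ (N ∸ i) * s i))
sumℚ-scale N s zero    _     = ℚ.*-zeroˡ (toℚ (2 ^ N))
sumℚ-scale N s (suc k) k<N = begin
  (sumℚ k t ℚ.+ t k) ℚ.* toℚ (2 ^ N)                  ≡⟨ ℚ.*-distribʳ-+ (toℚ (2 ^ N)) (sumℚ k t) (t k) ⟩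
  sumℚ k t ℚ.* toℚ (2 ^ N) ℚ.+ t k ℚ.* toℚ (2 ^ N)   ≡⟨ cong₂ ℚ._+_ (sumℚ-scale N s k (ℕ.<⇒≤ k<N)) (halfPow-scale (ℕ.<⇒≤ k<N) (s k)) ⟩
  toℚ (sumN k t′) ℚ.+ toℚ (t′ k)                      ≡⟨ toℚ-+ (sumN k t′) (t′ k) ⟨
  toℚ (sumN k t′ + t′ k)                              ∎
  where
  open ≡-Reasoning
  t : ℕ → ℚ.ℚ
  t i = halfPow i ℚ.* toℚ (s i)
  t′ : ℕ → ℕ
  t′ i = 2 ^ (N ∸ i) * s i

cancel-scale : ∀ X E S c .{{_ : ℕ.NonZero c}} (e : ℚ.ℚ) → e ℚ.* toℚ c ≡ toℚ E →
               X * c ≤ E * S → toℚ X ℚ.≤ e ℚ.* toℚ S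
cancel-scale X E S c e scaled Xc≤ES = ℚ.*-cancelʳ-≤-pos (toℚ c) {{toℚ-positive c}} (begin
  toℚ X ℚ.* toℚ c          ≡⟨ toℚ-* X c ⟨
  toℚ (X * c)              ≤⟨ toℚ-mono-≤ Xc≤ES ⟩
  toℚ (E * S)              ≡⟨ toℚ-* E S ⟩
  toℚ E ℚ.* toℚ S          ≡⟨ cong (ℚ._* toℚ S) scaled ⟨
  e ℚ.* toℚ c ℚ.* toℚ S    ≡⟨ solve 3 (λ e c s → (e :* c) :* s := (e :* s) :* c) refl e (toℚ c) (toℚ S) ⟩
  e ℚ.* toℚ S ℚ.* toℚ c    ∎)
  where open ℚ.≤-Reasoning

module Pebbling {n} (G : SimpleGraph n) where

  open Balls G

  -- ω u w = 2^(n ∸ d(u,w)), and 0 if w is not reachable from u.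
  ω : Fin n → Fin n → ℕ
  ω u w = weight n (λ j → ball G j u w)

  scaledEf : Fin n → ℕ
  scaledEf u = sumN n (λ i → 2 ^ (n ∸ i) * sphereSize G i u)

  ball-monotone : ∀ u w → Monotone (λ j → ball G j u w)
  ball-monotone u w j = ball-suc⁺ j u w

  ω-self : ∀ w → 2 ^ n ≤ ω w w
  ω-self w = weight-≥ n _ (ball-monotone w w) 0 (ℕ.≤-<-trans z≤n (toℕ<n w)) (ball-center 0 w)

  ω-edge : ∀ a b w → T (adj G a b) → ω b w ≤ 2 * ω a w
  ω-edge a b w ab with firstTrue (λ j → ball G j b w) n
  ... | never none = ℕ.≤-trans (ℕ.≤-reflexive (weight-never n _ none)) z≤n
  ... | at d d<n bd before with e , e<n , e≤1+d , ae ← ball-radius<n (suc d) a w (ball-cons d a b w ab bd) =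
    begin
      ω b w              ≡⟨ weight-at n _ (ball-monotone b w) d d<n bd before ⟩
      2 ^ (n ∸ d)        ≤⟨ ℕ.^-monoʳ-≤ 2 (m∸n≤1+m∸[1+n] n d) ⟩
      2 * 2 ^ (n ∸ suc d) ≤⟨ ℕ.*-monoʳ-≤ 2 (ℕ.^-monoʳ-≤ 2 (ℕ.∸-monoʳ-≤ n e≤1+d)) ⟩
      2 * 2 ^ (n ∸ e)    ≤⟨ ℕ.*-monoʳ-≤ 2 (weight-≥ n _ (ball-monotone a w) e e<n ae) ⟩
      2 * ω a w          ∎
    where open ℕ.≤-Reasoning

  jump-ball≡sphere : ∀ u w i → jump (λ j → ball G j u w) i ≡ sphere G i u w
  jump-ball≡sphere u w zero    = refl
  jump-ball≡sphere u w (suc i) = refl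

  sum-ω : ∀ u → sum (ω u) ≡ scaledEf u
  sum-ω u = begin
    sum (ω u)
      ≡⟨ sum-sumN n (λ i w → 2 ^ (n ∸ i) * 𝟙 (jump (λ j → ball G j u w) i)) ⟩
    sumN n (λ i → sum (λ w → 2 ^ (n ∸ i) * 𝟙 (jump (λ j → ball G j u w) i)))
      ≡⟨ sumN-cong n (λ i → sym (*-distribˡ-sum (2 ^ (n ∸ i)) (λ w → 𝟙 (jump (λ j → ball G j u w) i)))) ⟩
    sumN n (λ i → 2 ^ (n ∸ i) * sum (λ w → 𝟙 (jump (λ j → ball G j u w) i)))
      ≡⟨ sumN-cong n (λ i → cong (2 ^ (n ∸ i) *_) (begin
           sum (λ w → 𝟙 (jump (λ j → ball G j u w) i)) ≡⟨ sum-cong-≗ (cong 𝟙 ∘ λ w → jump-ball≡sphere u w i) ⟩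
           sum (𝟙 ∘ sphere G i u)                     ≡⟨ sumFin≡sum (𝟙 ∘ sphere G i u) ⟨
           sphereSize G i u                            ∎)) ⟩
    scaledEf u
      ∎
    where open ≡-Reasoning

  ef*2ⁿ≡scaledEf : ∀ u → ef G u ℚ.* toℚ (2 ^ n) ≡ toℚ (scaledEf u)
  ef*2ⁿ≡scaledEf u = sumℚ-scale n (λ i → sphereSize G i u) n ℕ.≤-refl

  potential : Distribution n → Fin n → ℕ
  potential P w = sum (λ u → P u * ω u w)

  move-balance : ∀ {P Q} (m : Move G P Q) w →
                 potential Q w + 2 * ω (Move.from m) w ≡ potential P w + 1 * ω (Move.to m) w
  move-balance {P} {Q} m w = begin
    potential Q w + 2 * ω a w
      ≡⟨ cong (potential Q w +_) (sum-pointMass a 2 (λ x → ω x w)) ⟨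
    potential Q w + sum (λ x → pointMass a 2 x * ω x w)
      ≡⟨ weighted-sum-+ Q (pointMass a 2) (λ x → ω x w) ⟨
    sum (λ x → (Q x + pointMass a 2 x) * ω x w)
      ≡⟨ sum-cong-≗ (λ x → cong (_* ω x w) (Move.result m x)) ⟩
    sum (λ x → (P x + pointMass b 1 x) * ω x w)
      ≡⟨ weighted-sum-+ P (pointMass b 1) (λ x → ω x w) ⟩
    potential P w + sum (λ x → pointMass b 1 x * ω x w)
      ≡⟨ cong (potential P w +_) (sum-pointMass b 1 (λ x → ω x w)) ⟩
    potential P w + 1 * ω b w
      ∎
    where
    open ≡-Reasoning
    a b : Fin n
    a = Move.from m
    b = Move.to m

  potential-move : ∀ {P Q} → Move G P Q → ∀ w → potential Q w ≤ potential P w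
  potential-move {P} {Q} m w = ℕ.+-cancelʳ-≤ (2 * ω a w) (potential Q w) (potential P w) (begin
    potential Q w + 2 * ω a w  ≡⟨ move-balance m w ⟩
    potential P w + 1 * ω b w  ≤⟨ ℕ.+-monoʳ-≤ (potential P w) (ℕ.≤-reflexive (ℕ.*-identityˡ (ω b w))) ⟩
    potential P w + ω b w      ≤⟨ ℕ.+-monoʳ-≤ (potential P w) (ω-edge a b w (from T-≡ (Move.isEdge m))) ⟩
    potential P w + 2 * ω a w  ∎)
    where
    open ℕ.≤-Reasoning
    a b : Fin n
    a = Move.from m
    b = Move.to m

  potential-moves : ∀ {P Q} → Moves G P Q → ∀ w → potential Q w ≤ potential P w
  potential-moves ε        w = ℕ.≤-refl
  potential-moves (m ◅ ms) w = ℕ.≤-trans (potential-moves ms w) (potential-move m w)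

  reachable-bound : ∀ P k w → KReachable G P k w → k * 2 ^ n ≤ potential P w
  reachable-bound P k w (Q , moves , k≤Qw) = begin
    k * 2 ^ n       ≤⟨ ℕ.*-mono-≤ k≤Qw (ω-self w) ⟩
    Q w * ω w w     ≤⟨ term≤sum (λ u → Q u * ω u w) w ⟩
    potential Q w   ≤⟨ potential-moves moves w ⟩
    potential P w   ∎
    where open ℕ.≤-Reasoning

  total-potential : ∀ P → sum (potential P) ≡ sum (λ u → P u * scaledEf u)
  total-potential P = begin
    sum (λ w → sum (λ u → P u * ω u w))  ≡⟨ ∑-comm (λ u w → P u * ω u w) ⟨
    sum (λ u → sum (λ w → P u * ω u w))  ≡⟨ sum-cong-≗ (λ u → *-distribˡ-sum (P u) (ω u)) ⟨
    sum (λ u → P u * sum (ω u))          ≡⟨ sum-cong-≗ (λ u → cong (P u *_) (sum-ω u)) ⟩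
    sum (λ u → P u * scaledEf u)         ∎
    where open ≡-Reasoning

  excess-bound : ∀ P → Solvable G P → ∀ w e → IsExc G P w e → suc e * 2 ^ n ≤ potential P w
  excess-bound P solvable w e (inj₁ (_ , reach , _))      = reachable-bound P (suc e) w reach
  excess-bound P solvable w e (inj₂ (unreachable , _)) = ⊥-elim (unreachable (solvable w))

  total-excess-bound : ∀ P → Solvable G P → ∀ exc → (∀ w → IsExc G P w (exc w)) →
                       (n + TE exc) * 2 ^ n ≤ sum (λ u → P u * scaledEf u)
  total-excess-bound P solvable exc isExc = begin
    (n + TE exc) * 2 ^ n             ≡⟨ cong (λ t → (n + t) * 2 ^ n) (sumFin≡sum exc) ⟩
    (n + sum exc) * 2 ^ n            ≡⟨ cong (_* 2 ^ n) (sum-suc exc) ⟨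
    sum (suc ∘ exc) * 2 ^ n          ≡⟨ *-distribʳ-sum (2 ^ n) (suc ∘ exc) ⟩
    sum (λ w → suc (exc w) * 2 ^ n)  ≤⟨ sum-mono-≤ (λ w → excess-bound P solvable w (exc w) (isExc w)) ⟩
    sum (potential P)                ≡⟨ total-potential P ⟩
    sum (λ u → P u * scaledEf u)     ∎
    where open ℕ.≤-Reasoning

module _ {n} (G : SimpleGraph n) (vt : VertexTransitive G) where

  open Pebbling G

  scaledEf-invariant : ∀ u v → scaledEf u ≡ scaledEf v
  scaledEf-invariant u v with σ , aut , refl ← vt u v =
    sumN-cong n (λ i → cong (2 ^ (n ∸ i) *_) (sym (Automorphism.sphereSize-aut G σ aut i u)))

  weighted-size : ∀ v P → sum (λ u → P u * scaledEf u) ≡ scaledEf v * size P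
  weighted-size v P = begin
    sum (λ u → P u * scaledEf u)  ≡⟨ sum-cong-≗ (λ u → cong (P u *_) (scaledEf-invariant u v)) ⟩
    sum (λ u → P u * scaledEf v)  ≡⟨ *-distribʳ-sum (scaledEf v) P ⟨
    sum P * scaledEf v            ≡⟨ cong (_* scaledEf v) (sumFin≡sum P) ⟨
    size P * scaledEf v           ≡⟨ ℕ.*-comm (size P) (scaledEf v) ⟩
    scaledEf v * size P           ∎
    where open ≡-Reasoning

corollary2p2 : ∀ (n : ℕ) (G : SimpleGraph n) → VertexTransitive G →
    ∀ (v : Fin n) (P : Distribution n) → Solvable G P →
    ∀ (exc : Fin n → ℕ) → (∀ w → IsExc G P w (exc w)) →
    toℚ (n + TE exc) ℚ.≤ ef G v ℚ.* toℚ (size P)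
corollary2p2 n G vt v P solvable exc isExc =
  cancel-scale (n + TE exc) (scaledEf v) (size P) (2 ^ n) {{ℕ.m^n≢0 2 n}} (ef G v) (ef*2ⁿ≡scaledEf v) (begin
    (n + TE exc) * 2 ^ n          ≤⟨ total-excess-bound P solvable exc isExc ⟩
    sum (λ u → P u * scaledEf u)  ≡⟨ weighted-size G vt v P ⟩
    scaledEf v * size P           ∎)
  where
  open Pebbling G
  open ℕ.≤-Reasoning
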